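{- For all $n\geq 1$, \[\mathrm{num}_{\mathcal B}(2n,x)=(1+x)^{2n}\,\mathrm{num}_{\mathcal B}(n,x^2)+f_{2n}(x)\,\mathrm{num}_{\mathcal B}(2n-2,x),\qquad\text{where } f_{2n}(x)=\prod_{i=1}^{\mathrm{val}_2(2n)}(1+x^{2^i}).\]
   Context: $\mathcal B(m)$ is the set of binary partitions of $m$ (all parts powers of $2$) and $m_\lambda(i)$ the number of parts of $\lambda$ equal to $i$. For $m\ge1$ and $\lambda\in\mathcal B(m)$ let $h_{\mathcal B,\lambda}(x)=\prod_{i=0}^{\lfloor\log_2 m\rfloor}(1+x^{2^i})^{\lfloor m/2^i\rfloor-m_\lambda(2^i)}$ and $\mathrm{num}_{\mathcal B}(m,x)=\sum_{\lambda\in\mathcal B(m)}h_{\mathcal B,\lambda}(x)$; set $\mathrm{num}_{\mathcal B}(0,x)=1$. $\mathrm{val}_2$ is the $2$-adic valuation. -}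

module Defs where

open import Data.Nat using (ℕ; zero; suc; _+_; _*_; _∸_; _^_; _≤ᵇ_; _≡ᵇ_)
open import Data.Nat.DivMod using (_/_; _%_)
open import Data.Nat.Logarithm using (⌊log₂_⌋)
open import Data.Bool using (if_then_else_)
open import Data.List using (List; []; _∷_; map; concatMap; filter; foldr; upTo; zip)
open import Data.Nat.ListAction using (sum)
open import Data.Nat.Properties using (m^n≢0)
open import Relation.Binary.PropositionalEquality using (_≡_)

-- Polynomials with natural-number coefficients, represented by their
-- coefficient sequence (k ↦ coefficient of x^k).  All polynomials built
-- below have finite support.

Poly : Set
Poly = ℕ → ℕ

_≈ᴾ_ : Poly → Poly → Set
p ≈ᴾ q = ∀ k → p k ≡ q k

infix 4 _≈ᴾ_
infixl 6 _⊕_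
infixl 7 _⊛_
infixr 8 _^ᴾ_

oneᴾ : Poly
oneᴾ zero    = 1
oneᴾ (suc _) = 0

Xᴾ^ : ℕ → Poly
Xᴾ^ e k = if e ≡ᵇ k then 1 else 0

_⊕_ : Poly → Poly → Poly
(p ⊕ q) k = p k + q k

_⊛_ : Poly → Poly → Poly
(p ⊛ q) k = sum (map (λ i → p i * q (k ∸ i)) (upTo (suc k)))

_^ᴾ_ : Poly → ℕ → Poly
p ^ᴾ zero  = oneᴾ
p ^ᴾ suc e = p ⊛ (p ^ᴾ e)

sub² : Poly → Poly
sub² p k = if k % 2 ≡ᵇ 0 then p (k / 2) else 0

sumᴾ : List Poly → Poly
sumᴾ = foldr _⊕_ (λ _ → 0)

prodᴾ : List Poly → Poly
prodᴾ = foldr _⊛_ oneᴾ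

onePlusX2^ : ℕ → Poly
onePlusX2^ i = oneᴾ ⊕ Xᴾ^ (2 ^ i)

-- A partition λ of m into the parts 2^0, …, 2^L (L = ⌊log₂ m⌋) is encoded
-- by its multiplicity list [m_λ(2^0), …, m_λ(2^L)].  (Powers of 2 larger
-- than m cannot occur as parts.)

multLists : List ℕ → ℕ → List (List ℕ)
multLists []       zero    = [] ∷ []
multLists []       (suc _) = []
multLists (p ∷ ps) m =
  concatMap (λ c → map (c ∷_) (multLists ps (m ∸ c * p)))
            (Data.List.filter (λ c → Data.Bool.T? (c * p ≤ᵇ m)) (upTo (suc m)))
  where import Data.Bool

expsOf : ℕ → List ℕ
expsOf m = upTo (suc ⌊log₂ m ⌋)

𝓑 : ℕ → List (List ℕ)
𝓑 m = multLists (map (2 ^_) (expsOf m)) m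

h𝓑 : ℕ → List ℕ → Poly
h𝓑 m λm = prodᴾ (map (λ { (i , c) → onePlusX2^ i ^ᴾ ((_/_ m (2 ^ i) {{m^n≢0 2 i}}) ∸ c) })
                      (zip (expsOf m) λm))
  where open import Data.Product using (_,_)

num𝓑 : ℕ → Poly
num𝓑 zero        = oneᴾ
num𝓑 m@(suc _)   = sumᴾ (map (h𝓑 m) (𝓑 m))

-- 2-adic valuation (val₂ 0 := 0, irrelevant here), computed with fuel n,
-- which suffices since val₂ n ≤ n.
val₂-fuel : ℕ → ℕ → ℕ
val₂-fuel zero       _ = 0
val₂-fuel (suc fuel) zero = 0
val₂-fuel (suc fuel) n@(suc _) =
  if n % 2 ≡ᵇ 0 then suc (val₂-fuel fuel (n / 2)) else 0

val₂ : ℕ → ℕ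
val₂ n = val₂-fuel n n

f : ℕ → Poly
f m = prodᴾ (map (λ j → onePlusX2^ (suc j)) (upTo (val₂ m)))

{-# OPTIONS --safe #-}
-- Sort the binary partitions of 2n by the multiplicity c of the part 1.  For c = 0 they are the
-- doubles of the partitions of n, and doubling turns each factor 1 + x^(2^i) into 1 + x^(2^(i+1)):
-- this is the substitution x ↦ x², next to the untouched factor (1 + x)^(2n) of the part 1.
-- For c = 1 the remainder 2n − 1 is odd, so nothing is left.  For c ≥ 2, deleting two 1s is a
-- bijection onto the partitions of 2n − 2 which keeps the exponent of 1 + x, while for i ≥ 1 the
-- exponent of 1 + x^(2^i) drops by ⌊2n/2^i⌋ − ⌊(2n−2)/2^i⌋, that is by 1 if 2^i divides 2n and by
-- 0 otherwise; these lost factors multiply to f_{2n}.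
module Submission where

open import Defs
open import Algebra.Bundles using (CommutativeMonoid; Semiring; CommutativeSemiring)
open import Algebra.Structures using (IsCommutativeMonoid)
open import Algebra.Structures.Biased using (isCommutativeMonoidˡ; isCommutativeSemiringˡ)
open import Data.Bool using (true; false; if_then_else_; T; T?)
open import Data.Empty using (⊥-elim)
open import Data.List using (List; []; _∷_; _++_; [_]; _∷ʳ_; map; foldr; applyUpTo; upTo; zip; concatMap; filter)
open import Data.List.Properties
  using (map-cong; map-++; map-∘; map-upTo; upTo-∷ʳ; filter-++; filter-accept; filter-reject; ++-identityʳ)
open import Data.Nat
  using (ℕ; zero; suc; pred; _+_; _∸_; _^_; _≤_; _<_; _≥_; z≤n; s≤s; _≡ᵇ_; _≤ᵇ_; _⊓_; _<?_; ⌊_/2⌋; NonZero)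
open import Data.Nat.DivMod
  using ( _/_; _%_; m*n%n≡0; m*n/n≡m; [m+kn]%n≡m%n; +-distrib-/-∣ʳ; /-monoˡ-≤; m/n*n≤m; m/n≤m
        ; m<n⇒m/n≡0; m/n/o≡m/[n*o]; n/1≡n)
open import Data.Nat.Divisibility using (n∣m*n)
open import Data.Nat.Induction using (<-wellFounded)
open import Data.Nat.Logarithm using (⌊log₂_⌋)
open import Data.Nat.Logarithm.Core using (⌊log2⌋)
open import Data.Nat.Properties
open import Data.Product using (_×_; _,_; proj₁; proj₂)
open import Data.Sum using (inj₁; inj₂)
open import Function using (_∘_)
open import Induction.WellFounded using (Acc; acc)
open import Level using (0ℓ)
open import Relation.Binary.Bundles using (Setoid)
open import Relation.Binary.Structures using (IsEquivalence)
import Relation.Binary.Reasoning.Setoid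
import Relation.Binary.PropositionalEquality as ≡
open ≡ using (_≡_; cong; cong₂; subst; module ≡-Reasoning)
open import Relation.Nullary using (Dec; yes; no)
open import Relation.Unary using (Decidable)

double : ℕ → ℕ
double zero    = zero
double (suc n) = suc (suc (double n))

module CommutativeMonoidSum {c ℓ} (M : CommutativeMonoid c ℓ) where
  open CommutativeMonoid M
  open Relation.Binary.Reasoning.Setoid setoid

  ∑ : (ℕ → Carrier) → ℕ → Carrier
  ∑ F zero    = ε
  ∑ F (suc N) = F 0 ∙ ∑ (F ∘ suc) N

  foldr-map-applyUpTo : ∀ (F : ℕ → Carrier) g N →
                        foldr _∙_ ε (map F (applyUpTo g N)) ≡ ∑ (F ∘ g) N
  foldr-map-applyUpTo F g zero    = ≡.refl
  foldr-map-applyUpTo F g (suc N) = cong (F (g 0) ∙_) (foldr-map-applyUpTo F (g ∘ suc) N)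

  ∑-cong : ∀ {F G} N → (∀ i → i < N → F i ≈ G i) → ∑ F N ≈ ∑ G N
  ∑-cong zero    F≈G = refl
  ∑-cong (suc N) F≈G = ∙-cong (F≈G 0 (s≤s z≤n)) (∑-cong N (λ i i<N → F≈G (suc i) (s≤s i<N)))

  ∑-zero : ∀ {F} N → (∀ i → i < N → F i ≈ ε) → ∑ F N ≈ ε
  ∑-zero zero    F≈ε = refl
  ∑-zero (suc N) F≈ε = trans (∙-cong (F≈ε 0 (s≤s z≤n)) (∑-zero N (λ i i<N → F≈ε (suc i) (s≤s i<N))))
                             (identityˡ ε)

  ∑-truncate : ∀ {F} w K → w ≤ K → (∀ j → w ≤ j → j < K → F j ≈ ε) → ∑ F K ≈ ∑ F w
  ∑-truncate zero    K       _         F≈ε = ∑-zero K (λ j → F≈ε j z≤n)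
  ∑-truncate (suc w) (suc K) (s≤s w≤K) F≈ε =
    ∙-cong refl (∑-truncate w K w≤K (λ j w≤j j<K → F≈ε (suc j) (s≤s w≤j) (s≤s j<K)))

  ∑-snoc : ∀ F N → ∑ F (suc N) ≈ ∑ F N ∙ F N
  ∑-snoc F zero    = trans (identityʳ (F 0)) (sym (identityˡ (F 0)))
  ∑-snoc F (suc N) = trans (∙-cong refl (∑-snoc (F ∘ suc) N)) (sym (assoc _ _ _))

  ∑-∙ : ∀ F G N → ∑ (λ i → F i ∙ G i) N ≈ ∑ F N ∙ ∑ G N
  ∑-∙ F G zero    = sym (identityˡ ε)
  ∑-∙ F G (suc N) = trans (∙-cong refl (∑-∙ (F ∘ suc) (G ∘ suc) N)) (interchange _ _ _ _)
    where open import Algebra.Properties.CommutativeSemigroup commutativeSemigroup using (interchange)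

  ∑-reverse : ∀ F N → ∑ F N ≈ ∑ (λ i → F (N ∸ suc i)) N
  ∑-reverse F zero    = refl
  ∑-reverse F (suc N) = trans (∑-snoc F N) (trans (∙-cong (∑-reverse F N) refl) (comm _ _))

  ∑-evens : ∀ F N → (∀ i → F (suc (double i)) ≈ ε) → ∑ F (double N) ≈ ∑ (F ∘ double) N
  ∑-evens F zero    odd≈ε = refl
  ∑-evens F (suc N) odd≈ε =
    ∙-cong refl (trans (∙-cong (odd≈ε 0) (∑-evens (F ∘ suc ∘ suc) N (odd≈ε ∘ suc))) (identityˡ _))

  ∑-triangle : ∀ (G : ℕ → ℕ → Carrier) k →
               ∑ (λ i → ∑ (λ j → G j i) (suc i)) (suc k) ≈
               ∑ (λ j → ∑ (λ l → G j (j + l)) (suc (k ∸ j))) (suc k)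
  ∑-triangle G zero    = refl
  ∑-triangle G (suc k) = begin
    ∑ column (suc (suc k))                              ≈⟨ ∑-snoc column (suc k) ⟩
    ∑ column (suc k) ∙ column (suc k)                   ≈⟨ ∙-cong (∑-triangle G k) (∑-snoc (λ j → G j (suc k)) (suc k)) ⟩
    ∑ (row k) (suc k) ∙ (∑ (λ j → G j (suc k)) (suc k) ∙ G (suc k) (suc k))
      ≈⟨ sym (assoc _ _ _) ⟩
    ∑ (row k) (suc k) ∙ ∑ (λ j → G j (suc k)) (suc k) ∙ G (suc k) (suc k)
      ≈⟨ ∙-cong (sym (∑-∙ (row k) (λ j → G j (suc k)) (suc k))) row-last ⟩
    ∑ (λ j → row k j ∙ G j (suc k)) (suc k) ∙ row (suc k) (suc k)
      ≈⟨ ∙-cong (∑-cong (suc k) row-extend) refl ⟩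
    ∑ (row (suc k)) (suc k) ∙ row (suc k) (suc k)       ≈⟨ sym (∑-snoc (row (suc k)) (suc k)) ⟩
    ∑ (row (suc k)) (suc (suc k))                       ∎
    where
    column : ℕ → Carrier
    column i = ∑ (λ j → G j i) (suc i)
    row : ℕ → ℕ → Carrier
    row k j = ∑ (λ l → G j (j + l)) (suc (k ∸ j))
    row-last : G (suc k) (suc k) ≈ row (suc k) (suc k)
    row-last = sym (begin
      row (suc k) (suc k)       ≡⟨ cong (∑ (λ l → G (suc k) (suc k + l)) ∘ suc) (n∸n≡0 k) ⟩
      G (suc k) (suc k + 0) ∙ ε ≈⟨ identityʳ _ ⟩
      G (suc k) (suc k + 0)     ≡⟨ cong (G (suc k)) (+-identityʳ (suc k)) ⟩
      G (suc k) (suc k)         ∎)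
    row-extend : ∀ j → j < suc k → row k j ∙ G j (suc k) ≈ row (suc k) j
    row-extend j (s≤s j≤k) = begin
      row k j ∙ G j (suc k)                           ≡⟨ cong (λ i → row k j ∙ G j i) (≡.sym j+suc[k∸j]≡suc[k]) ⟩
      row k j ∙ G j (j + suc (k ∸ j))                 ≈⟨ sym (∑-snoc (λ l → G j (j + l)) (suc (k ∸ j))) ⟩
      ∑ (λ l → G j (j + l)) (suc (suc (k ∸ j)))       ≡⟨ cong (∑ (λ l → G j (j + l)) ∘ suc) (≡.sym (+-∸-assoc 1 j≤k)) ⟩
      row (suc k) j                                   ∎
      where
      j+suc[k∸j]≡suc[k] : j + suc (k ∸ j) ≡ suc k
      j+suc[k∸j]≡suc[k] = ≡.trans (+-suc j (k ∸ j)) (cong suc (m+[n∸m]≡n j≤k))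

module SemiringSum {c ℓ} (R : Semiring c ℓ) where
  open Semiring R hiding (_+_)
  open CommutativeMonoidSum +-commutativeMonoid public

  ∑-distribˡ : ∀ a F N → ∑ (λ i → a * F i) N ≈ a * ∑ F N
  ∑-distribˡ a F zero    = sym (zeroʳ a)
  ∑-distribˡ a F (suc N) = trans (+-cong refl (∑-distribˡ a (F ∘ suc) N)) (sym (distribˡ a _ _))

  ∑-distribʳ : ∀ a F N → ∑ (λ i → F i * a) N ≈ ∑ F N * a
  ∑-distribʳ a F zero    = sym (zeroˡ a)
  ∑-distribʳ a F (suc N) = trans (+-cong refl (∑-distribʳ a (F ∘ suc) N)) (sym (distribʳ a _ _))

-- Imported only now: inside the two modules above they would clash with the fields of M and R.
open import Data.Nat using (_*_)
open ≡ using (refl; sym; trans)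

module Σℕ = SemiringSum +-*-semiring

zeroᴾ : Poly
zeroᴾ _ = 0

≈ᴾ-isEquivalence : IsEquivalence _≈ᴾ_
≈ᴾ-isEquivalence = record
  { refl  = λ _ → refl
  ; sym   = λ p≈q k → sym (p≈q k)
  ; trans = λ p≈q q≈r k → trans (p≈q k) (q≈r k)
  }

Poly-setoid : Setoid 0ℓ 0ℓ
Poly-setoid = record { isEquivalence = ≈ᴾ-isEquivalence }

open IsEquivalence ≈ᴾ-isEquivalence public
  using () renaming (refl to ≈ᴾ-refl; sym to ≈ᴾ-sym; trans to ≈ᴾ-trans; reflexive to ≈ᴾ-reflexive)

module ≈ᴾ-Reasoning = Relation.Binary.Reasoning.Setoid Poly-setoid

⊛-coeff : ∀ p q k → (p ⊛ q) k ≡ Σℕ.∑ (λ i → p i * q (k ∸ i)) (suc k)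
⊛-coeff p q k = Σℕ.foldr-map-applyUpTo (λ i → p i * q (k ∸ i)) (λ i → i) (suc k)

⊕-cong : ∀ {p p′ q q′} → p ≈ᴾ p′ → q ≈ᴾ q′ → p ⊕ q ≈ᴾ p′ ⊕ q′
⊕-cong p≈p′ q≈q′ k = cong₂ _+_ (p≈p′ k) (q≈q′ k)

⊕-congˡ : ∀ p {q q′} → q ≈ᴾ q′ → p ⊕ q ≈ᴾ p ⊕ q′
⊕-congˡ p = ⊕-cong (≈ᴾ-refl {p})

⊕-isCommutativeMonoid : IsCommutativeMonoid _≈ᴾ_ _⊕_ zeroᴾ
⊕-isCommutativeMonoid = isCommutativeMonoidˡ record
  { isSemigroup = record
    { isMagma = record { isEquivalence = ≈ᴾ-isEquivalence ; ∙-cong = ⊕-cong }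
    ; assoc   = λ p q r k → +-assoc (p k) (q k) (r k)
    }
  ; identityˡ = λ p k → refl
  ; comm      = λ p q k → +-comm (p k) (q k)
  }

⊛-cong : ∀ {p p′ q q′} → p ≈ᴾ p′ → q ≈ᴾ q′ → p ⊛ q ≈ᴾ p′ ⊛ q′
⊛-cong {p} {p′} {q} {q′} p≈p′ q≈q′ k = begin
  (p ⊛ q) k                                ≡⟨ ⊛-coeff p q k ⟩
  Σℕ.∑ (λ i → p i * q (k ∸ i)) (suc k)     ≡⟨ Σℕ.∑-cong (suc k) (λ i _ → cong₂ _*_ (p≈p′ i) (q≈q′ (k ∸ i))) ⟩
  Σℕ.∑ (λ i → p′ i * q′ (k ∸ i)) (suc k)   ≡⟨ sym (⊛-coeff p′ q′ k) ⟩
  (p′ ⊛ q′) k                              ∎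
  where open ≡-Reasoning

⊛-comm : ∀ p q → p ⊛ q ≈ᴾ q ⊛ p
⊛-comm p q k = begin
  (p ⊛ q) k                                      ≡⟨ ⊛-coeff p q k ⟩
  Σℕ.∑ (λ i → p i * q (k ∸ i)) (suc k)           ≡⟨ Σℕ.∑-reverse (λ i → p i * q (k ∸ i)) (suc k) ⟩
  Σℕ.∑ (λ i → p (k ∸ i) * q (k ∸ (k ∸ i))) (suc k) ≡⟨ Σℕ.∑-cong (suc k) swap ⟩
  Σℕ.∑ (λ i → q i * p (k ∸ i)) (suc k)           ≡⟨ sym (⊛-coeff q p k) ⟩
  (q ⊛ p) k                                      ∎
  where
  open ≡-Reasoning
  swap : ∀ i → i < suc k → p (k ∸ i) * q (k ∸ (k ∸ i)) ≡ q i * p (k ∸ i)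
  swap i (s≤s i≤k) = trans (cong (λ j → p (k ∸ i) * q j) (m∸[m∸n]≡n i≤k)) (*-comm (p (k ∸ i)) (q i))

⊛-identityˡ : ∀ p → oneᴾ ⊛ p ≈ᴾ p
⊛-identityˡ p k = begin
  (oneᴾ ⊛ p) k                        ≡⟨ ⊛-coeff oneᴾ p k ⟩
  1 * p k + Σℕ.∑ (λ _ → 0) k          ≡⟨ cong₂ _+_ (*-identityˡ (p k)) (Σℕ.∑-zero k (λ _ _ → refl)) ⟩
  p k + 0                             ≡⟨ +-identityʳ (p k) ⟩
  p k                                 ∎
  where open ≡-Reasoning

⊛-zeroˡ : ∀ p → zeroᴾ ⊛ p ≈ᴾ zeroᴾ
⊛-zeroˡ p k = trans (⊛-coeff zeroᴾ p k) (Σℕ.∑-zero (suc k) (λ _ _ → refl))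

⊛-distribʳ : ∀ p q r → (q ⊕ r) ⊛ p ≈ᴾ q ⊛ p ⊕ r ⊛ p
⊛-distribʳ p q r k = begin
  ((q ⊕ r) ⊛ p) k
    ≡⟨ ⊛-coeff (q ⊕ r) p k ⟩
  Σℕ.∑ (λ i → (q i + r i) * p (k ∸ i)) (suc k)
    ≡⟨ Σℕ.∑-cong (suc k) (λ i _ → *-distribʳ-+ (p (k ∸ i)) (q i) (r i)) ⟩
  Σℕ.∑ (λ i → q i * p (k ∸ i) + r i * p (k ∸ i)) (suc k)
    ≡⟨ Σℕ.∑-∙ (λ i → q i * p (k ∸ i)) (λ i → r i * p (k ∸ i)) (suc k) ⟩
  Σℕ.∑ (λ i → q i * p (k ∸ i)) (suc k) + Σℕ.∑ (λ i → r i * p (k ∸ i)) (suc k)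
    ≡⟨ sym (cong₂ _+_ (⊛-coeff q p k) (⊛-coeff r p k)) ⟩
  (q ⊛ p ⊕ r ⊛ p) k
    ∎
  where open ≡-Reasoning

⊛-assoc : ∀ p q r → (p ⊛ q) ⊛ r ≈ᴾ p ⊛ (q ⊛ r)
⊛-assoc p q r k = begin
  ((p ⊛ q) ⊛ r) k
    ≡⟨ ⊛-coeff (p ⊛ q) r k ⟩
  Σℕ.∑ (λ i → (p ⊛ q) i * r (k ∸ i)) (suc k)
    ≡⟨ Σℕ.∑-cong (suc k) (λ i _ → cong (_* r (k ∸ i)) (⊛-coeff p q i)) ⟩
  Σℕ.∑ (λ i → Σℕ.∑ (λ j → p j * q (i ∸ j)) (suc i) * r (k ∸ i)) (suc k)
    ≡⟨ Σℕ.∑-cong (suc k) (λ i _ → sym (Σℕ.∑-distribʳ (r (k ∸ i)) (λ j → p j * q (i ∸ j)) (suc i))) ⟩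
  Σℕ.∑ (λ i → Σℕ.∑ (λ j → term j i) (suc i)) (suc k)
    ≡⟨ Σℕ.∑-triangle term k ⟩
  Σℕ.∑ (λ j → Σℕ.∑ (λ l → term j (j + l)) (suc (k ∸ j))) (suc k)
    ≡⟨ Σℕ.∑-cong (suc k) (λ j _ → Σℕ.∑-cong (suc (k ∸ j)) (λ l _ → reindex j l)) ⟩
  Σℕ.∑ (λ j → Σℕ.∑ (λ l → p j * (q l * r (k ∸ j ∸ l))) (suc (k ∸ j))) (suc k)
    ≡⟨ Σℕ.∑-cong (suc k) (λ j _ → Σℕ.∑-distribˡ (p j) (λ l → q l * r (k ∸ j ∸ l)) (suc (k ∸ j))) ⟩
  Σℕ.∑ (λ j → p j * Σℕ.∑ (λ l → q l * r (k ∸ j ∸ l)) (suc (k ∸ j))) (suc k)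
    ≡⟨ Σℕ.∑-cong (suc k) (λ j _ → cong (p j *_) (sym (⊛-coeff q r (k ∸ j)))) ⟩
  Σℕ.∑ (λ j → p j * (q ⊛ r) (k ∸ j)) (suc k)
    ≡⟨ sym (⊛-coeff p (q ⊛ r) k) ⟩
  (p ⊛ (q ⊛ r)) k
    ∎
  where
  open ≡-Reasoning
  term : ℕ → ℕ → ℕ
  term j i = p j * q (i ∸ j) * r (k ∸ i)
  reindex : ∀ j l → term j (j + l) ≡ p j * (q l * r (k ∸ j ∸ l))
  reindex j l = trans (cong₂ (λ a b → p j * q a * r b) (m+n∸m≡n j l) (sym (∸-+-assoc k j l)))
                      (*-assoc (p j) _ _)

⊛-isCommutativeMonoid : IsCommutativeMonoid _≈ᴾ_ _⊛_ oneᴾ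
⊛-isCommutativeMonoid = isCommutativeMonoidˡ record
  { isSemigroup = record
    { isMagma = record { isEquivalence = ≈ᴾ-isEquivalence ; ∙-cong = ⊛-cong }
    ; assoc   = ⊛-assoc
    }
  ; identityˡ = ⊛-identityˡ
  ; comm      = ⊛-comm
  }

Poly-commutativeSemiring : CommutativeSemiring 0ℓ 0ℓ
Poly-commutativeSemiring = record
  { isCommutativeSemiring = isCommutativeSemiringˡ record
    { +-isCommutativeMonoid = ⊕-isCommutativeMonoid
    ; *-isCommutativeMonoid = ⊛-isCommutativeMonoid
    ; distribʳ              = ⊛-distribʳ
    ; zeroˡ                 = ⊛-zeroˡ
    }
  }

open CommutativeSemiring Poly-commutativeSemiring public using ()
  renaming (*-identityʳ to ⊛-identityʳ; zeroʳ to ⊛-zeroʳ; distribˡ to ⊛-distribˡ; +-identityʳ to ⊕-identityʳ)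

⊛-congˡ : ∀ p {q q′} → q ≈ᴾ q′ → p ⊛ q ≈ᴾ p ⊛ q′
⊛-congˡ p = ⊛-cong (≈ᴾ-refl {p})

⊛-congʳ : ∀ {p p′} q → p ≈ᴾ p′ → p ⊛ q ≈ᴾ p′ ⊛ q
⊛-congʳ q p≈p′ = ⊛-cong p≈p′ (≈ᴾ-refl {q})

open import Algebra.Properties.CommutativeSemigroup (CommutativeSemiring.*-commutativeSemigroup Poly-commutativeSemiring)
  using () renaming (interchange to ⊛-interchange; x∙yz≈y∙xz to x⊛yz≈y⊛xz)

module Σᴾ = SemiringSum (CommutativeSemiring.semiring Poly-commutativeSemiring)

open CommutativeMonoidSum (CommutativeSemiring.*-commutativeMonoid Poly-commutativeSemiring) using ()
  renaming (∑ to ∏; ∑-cong to ∏-cong; ∑-truncate to ∏-truncate; foldr-map-applyUpTo to prodᴾ-map-applyUpTo)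

double≡2* : ∀ n → double n ≡ 2 * n
double≡2* zero    = refl
double≡2* (suc n) = cong suc (trans (cong suc (double≡2* n)) (sym (+-suc n (n + 0))))

double-∸ : ∀ a b → double a ∸ double b ≡ double (a ∸ b)
double-∸ zero    zero    = refl
double-∸ zero    (suc b) = refl
double-∸ (suc a) zero    = refl
double-∸ (suc a) (suc b) = double-∸ a b

double-mono-≤ : ∀ {a b} → a ≤ b → double a ≤ double b
double-mono-≤ z≤n       = z≤n
double-mono-≤ (s≤s a≤b) = s≤s (s≤s (double-mono-≤ a≤b))

double-≡ᵇ : ∀ a b → (double a ≡ᵇ double b) ≡ (a ≡ᵇ b)
double-≡ᵇ zero    zero    = refl
double-≡ᵇ zero    (suc b) = refl
double-≡ᵇ (suc a) zero    = refl
double-≡ᵇ (suc a) (suc b) = double-≡ᵇ a b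

double-≢ᵇ-suc-double : ∀ a b → (double a ≡ᵇ suc (double b)) ≡ false
double-≢ᵇ-suc-double zero    b       = refl
double-≢ᵇ-suc-double (suc a) zero    = refl
double-≢ᵇ-suc-double (suc a) (suc b) = double-≢ᵇ-suc-double a b

n≤double[n] : ∀ n → n ≤ double n
n≤double[n] zero    = z≤n
n≤double[n] (suc n) = s≤s (m≤n⇒m≤1+n (n≤double[n] n))

m∸o≡[m∸n]+[n∸o] : ∀ {m n o} → o ≤ n → n ≤ m → m ∸ o ≡ (m ∸ n) + (n ∸ o)
m∸o≡[m∸n]+[n∸o] {m} {n} {o} o≤n n≤m = trans (cong (_∸ o) (sym (m∸n+n≡m n≤m))) (+-∸-assoc (m ∸ n) o≤n)

m*[2*n]≡double[m*n] : ∀ m n → m * (2 * n) ≡ double (m * n)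
m*[2*n]≡double[m*n] m n = begin
  m * (2 * n)    ≡⟨ *-comm m (2 * n) ⟩
  2 * n * m      ≡⟨ *-assoc 2 n m ⟩
  2 * (n * m)    ≡⟨ cong (2 *_) (*-comm n m) ⟩
  2 * (m * n)    ≡⟨ sym (double≡2* (m * n)) ⟩
  double (m * n) ∎
  where open ≡-Reasoning

double≡*2 : ∀ h → double h ≡ h * 2
double≡*2 h = trans (double≡2* h) (*-comm 2 h)

double%2≡0 : ∀ h → double h % 2 ≡ 0
double%2≡0 h = trans (cong (_% 2) (double≡*2 h)) (m*n%n≡0 h 2)

double/2≡id : ∀ h → double h / 2 ≡ h
double/2≡id h = trans (cong (_/ 2) (double≡*2 h)) (m*n/n≡m h 2)

suc-double%2≡1 : ∀ h → suc (double h) % 2 ≡ 1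
suc-double%2≡1 h = trans (cong (λ x → suc x % 2) (double≡*2 h)) ([m+kn]%n≡m%n 1 h 2)

suc-double/2≡id : ∀ h → suc (double h) / 2 ≡ h
suc-double/2≡id h =
  trans (cong (λ x → suc x / 2) (double≡*2 h)) (trans (+-distrib-/-∣ʳ 1 {d = 2} (n∣m*n h)) (m*n/n≡m h 2))

data Parity : ℕ → Set where
  even : ∀ h → Parity (double h)
  odd  : ∀ h → Parity (suc (double h))

parity : ∀ k → Parity k
parity zero = even zero
parity (suc k) with parity k
... | even h = odd h
... | odd h  = even (suc h)

sub²-double : ∀ p h → sub² p (double h) ≡ p h
sub²-double p h = cong₂ (λ b x → if b ≡ᵇ 0 then p x else 0) (double%2≡0 h) (double/2≡id h)

sub²-suc-double : ∀ p h → sub² p (suc (double h)) ≡ 0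
sub²-suc-double p h = cong (λ b → if b ≡ᵇ 0 then p (suc (double h) / 2) else 0) (suc-double%2≡1 h)

sub²-unique : ∀ {p r} → (∀ h → r (double h) ≡ p h) → (∀ h → r (suc (double h)) ≡ 0) → sub² p ≈ᴾ r
sub²-unique {p} r-even r-odd k with parity k
... | even h = trans (sub²-double p h) (sym (r-even h))
... | odd h  = trans (sub²-suc-double p h) (sym (r-odd h))

sub²-cong : ∀ {p q} → p ≈ᴾ q → sub² p ≈ᴾ sub² q
sub²-cong {p} {q} p≈q = sub²-unique (λ h → trans (sub²-double q h) (sym (p≈q h))) (sub²-suc-double q)

sub²-zeroᴾ : sub² zeroᴾ ≈ᴾ zeroᴾ
sub²-zeroᴾ = sub²-unique (λ _ → refl) (λ _ → refl)

sub²-oneᴾ : sub² oneᴾ ≈ᴾ oneᴾ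
sub²-oneᴾ = sub²-unique oneᴾ-double (λ _ → refl)
  where
  oneᴾ-double : ∀ h → oneᴾ (double h) ≡ oneᴾ h
  oneᴾ-double zero    = refl
  oneᴾ-double (suc h) = refl

sub²-Xᴾ^ : ∀ e → sub² (Xᴾ^ e) ≈ᴾ Xᴾ^ (double e)
sub²-Xᴾ^ e = sub²-unique (λ h → cong (if_then 1 else 0) (double-≡ᵇ e h))
                         (λ h → cong (if_then 1 else 0) (double-≢ᵇ-suc-double e h))

sub²-⊕ : ∀ p q → sub² (p ⊕ q) ≈ᴾ sub² p ⊕ sub² q
sub²-⊕ p q = sub²-unique (λ h → cong₂ _+_ (sub²-double p h) (sub²-double q h))
                         (λ h → cong₂ _+_ (sub²-suc-double p h) (sub²-suc-double q h))

sub²-⊛ : ∀ p q → sub² (p ⊛ q) ≈ᴾ sub² p ⊛ sub² q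
sub²-⊛ p q = sub²-unique even-coeff odd-coeff
  where
  open ≡-Reasoning
  term : ℕ → ℕ → ℕ
  term k i = sub² p i * sub² q (k ∸ i)
  odd-terms-vanish : ∀ k i → term k (suc (double i)) ≡ 0
  odd-terms-vanish k i = cong (_* sub² q (k ∸ suc (double i))) (sub²-suc-double p i)
  even-coeff : ∀ h → (sub² p ⊛ sub² q) (double h) ≡ (p ⊛ q) h
  even-coeff h = begin
    (sub² p ⊛ sub² q) (double h)
      ≡⟨ ⊛-coeff (sub² p) (sub² q) (double h) ⟩
    Σℕ.∑ (term (double h)) (suc (double h))
      ≡⟨ sym (+-identityʳ _) ⟩
    Σℕ.∑ (term (double h)) (suc (double h)) + 0
      ≡⟨ cong (Σℕ.∑ (term (double h)) (suc (double h)) +_) (sym (odd-terms-vanish (double h) h)) ⟩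
    Σℕ.∑ (term (double h)) (suc (double h)) + term (double h) (suc (double h))
      ≡⟨ sym (Σℕ.∑-snoc (term (double h)) (suc (double h))) ⟩
    Σℕ.∑ (term (double h)) (double (suc h))
      ≡⟨ Σℕ.∑-evens (term (double h)) (suc h) (odd-terms-vanish (double h)) ⟩
    Σℕ.∑ (term (double h) ∘ double) (suc h)
      ≡⟨ Σℕ.∑-cong (suc h) (λ i _ → cong₂ _*_ (sub²-double p i) (q-coeff i)) ⟩
    Σℕ.∑ (λ i → p i * q (h ∸ i)) (suc h)
      ≡⟨ sym (⊛-coeff p q h) ⟩
    (p ⊛ q) h
      ∎
    where
    q-coeff : ∀ i → sub² q (double h ∸ double i) ≡ q (h ∸ i)
    q-coeff i = trans (cong (sub² q) (double-∸ h i)) (sub²-double q (h ∸ i))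
  odd-coeff : ∀ h → (sub² p ⊛ sub² q) (suc (double h)) ≡ 0
  odd-coeff h = begin
    (sub² p ⊛ sub² q) (suc (double h))
      ≡⟨ ⊛-coeff (sub² p) (sub² q) (suc (double h)) ⟩
    Σℕ.∑ (term (suc (double h))) (double (suc h))
      ≡⟨ Σℕ.∑-evens (term (suc (double h))) (suc h) (odd-terms-vanish (suc (double h))) ⟩
    Σℕ.∑ (term (suc (double h)) ∘ double) (suc h)
      ≡⟨ Σℕ.∑-zero (suc h) (λ i i≤h → trans (cong (sub² p (double i) *_) (q-coeff (≤-pred i≤h))) (*-zeroʳ (sub² p (double i)))) ⟩
    0
      ∎
    where
    q-coeff : ∀ {i} → i ≤ h → sub² q (suc (double h) ∸ double i) ≡ 0
    q-coeff {i} i≤h = trans (cong (sub² q) (trans (+-∸-assoc 1 (double-mono-≤ i≤h)) (cong suc (double-∸ h i))))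
                            (sub²-suc-double q (h ∸ i))

^ᴾ-cong : ∀ {p p′} n → p ≈ᴾ p′ → p ^ᴾ n ≈ᴾ p′ ^ᴾ n
^ᴾ-cong zero    p≈p′ = ≈ᴾ-refl
^ᴾ-cong (suc n) p≈p′ = ⊛-cong p≈p′ (^ᴾ-cong n p≈p′)

^ᴾ-+ : ∀ p a b → p ^ᴾ (a + b) ≈ᴾ p ^ᴾ a ⊛ p ^ᴾ b
^ᴾ-+ p zero    b = ≈ᴾ-sym (⊛-identityˡ (p ^ᴾ b))
^ᴾ-+ p (suc a) b = ≈ᴾ-trans (⊛-congˡ p (^ᴾ-+ p a b)) (≈ᴾ-sym (⊛-assoc p (p ^ᴾ a) (p ^ᴾ b)))

sub²-^ᴾ : ∀ p n → sub² (p ^ᴾ n) ≈ᴾ sub² p ^ᴾ n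
sub²-^ᴾ p zero    = sub²-oneᴾ
sub²-^ᴾ p (suc n) = ≈ᴾ-trans (sub²-⊛ p (p ^ᴾ n)) (⊛-congˡ (sub² p) (sub²-^ᴾ p n))

sub²-onePlusX2^ : ∀ i → sub² (onePlusX2^ i) ≈ᴾ onePlusX2^ (suc i)
sub²-onePlusX2^ i = ≈ᴾ-trans (sub²-⊕ oneᴾ (Xᴾ^ (2 ^ i)))
  (⊕-cong sub²-oneᴾ (≈ᴾ-trans (sub²-Xᴾ^ (2 ^ i)) (≈ᴾ-reflexive (cong Xᴾ^ (double≡2* (2 ^ i))))))

sub²-∑ : ∀ F N → sub² (Σᴾ.∑ F N) ≈ᴾ Σᴾ.∑ (sub² ∘ F) N
sub²-∑ F zero    = sub²-zeroᴾ
sub²-∑ F (suc N) = ≈ᴾ-trans (sub²-⊕ (F 0) (Σᴾ.∑ (F ∘ suc) N)) (⊕-cong ≈ᴾ-refl (sub²-∑ (F ∘ suc) N))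

_/2^_ : ℕ → ℕ → ℕ
m /2^ e = _/_ m (2 ^ e) {{m^n≢0 2 e}}

/2^-suc : ∀ x e → x /2^ suc e ≡ (x / 2) /2^ e
/2^-suc x e = sym (m/n/o≡m/[n*o] x 2 (2 ^ e) {{_}} {{m^n≢0 2 e}} {{m^n≢0 2 (suc e)}})

double/2^suc : ∀ x e → double x /2^ suc e ≡ x /2^ e
double/2^suc x e = trans (/2^-suc (double x) e) (cong (_/2^ e) (double/2≡id x))

suc-double/2^suc : ∀ x e → suc (double x) /2^ suc e ≡ x /2^ e
suc-double/2^suc x e = trans (/2^-suc (suc (double x)) e) (cong (_/2^ e) (suc-double/2≡id x))

partFactor : ℕ → ℕ × ℕ → Poly
partFactor m (e , c) = onePlusX2^ e ^ᴾ (m /2^ e ∸ c)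

partitionWeight : ℕ → List ℕ → List ℕ → Poly
partitionWeight m es cs = prodᴾ (map (partFactor m) (zip es cs))

-- partitionSum m es r sums partitionWeight m es over the binary partitions of r with parts 2^e,
-- e ∈ es; the multiplicity c of the first part 2^e is summed over explicitly.
partitionSum : ℕ → List ℕ → ℕ → Poly
partitionSum m []       zero    = oneᴾ
partitionSum m []       (suc _) = zeroᴾ
partitionSum m (e ∷ es) r =
  Σᴾ.∑ (λ c → partFactor m (e , c) ⊛ partitionSum m es (r ∸ c * 2 ^ e)) (suc (r /2^ e))

sumᴾ-++ : ∀ ps qs → sumᴾ (ps ++ qs) ≈ᴾ sumᴾ ps ⊕ sumᴾ qs
sumᴾ-++ []       qs = ≈ᴾ-refl
sumᴾ-++ (p ∷ ps) qs k = trans (cong (p k +_) (sumᴾ-++ ps qs k)) (sym (+-assoc (p k) _ _))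

sumᴾ-map-concatMap : ∀ {A : Set} (h : A → Poly) (G : ℕ → List A) cs →
                     sumᴾ (map h (concatMap G cs)) ≈ᴾ sumᴾ (map (λ c → sumᴾ (map h (G c))) cs)
sumᴾ-map-concatMap h G []       = ≈ᴾ-refl
sumᴾ-map-concatMap h G (c ∷ cs) = ≈ᴾ-trans (≈ᴾ-reflexive (cong sumᴾ (map-++ h (G c) (concatMap G cs))))
  (≈ᴾ-trans (sumᴾ-++ (map h (G c)) (map h (concatMap G cs))) (⊕-cong ≈ᴾ-refl (sumᴾ-map-concatMap h G cs)))

sumᴾ-partitionWeight-∷ : ∀ m e es c css →
  sumᴾ (map (partitionWeight m (e ∷ es)) (map (c ∷_) css)) ≈ᴾ partFactor m (e , c) ⊛ sumᴾ (map (partitionWeight m es) css)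
sumᴾ-partitionWeight-∷ m e es c []         = ≈ᴾ-sym (⊛-zeroʳ (partFactor m (e , c)))
sumᴾ-partitionWeight-∷ m e es c (cs ∷ css) =
  ≈ᴾ-trans (⊕-cong ≈ᴾ-refl (sumᴾ-partitionWeight-∷ m e es c css))
           (≈ᴾ-sym (⊛-distribˡ (partFactor m (e , c)) (partitionWeight m es cs) _))

filter-upTo : ∀ {P : ℕ → Set} (P? : Decidable P) K → (∀ i → i < K → P i) → (∀ i → P i → i < K) →
              ∀ N → filter P? (upTo N) ≡ upTo (N ⊓ K)
filter-upTo P? K accept reject zero    = refl
filter-upTo P? K accept reject (suc N) = begin
  filter P? (upTo (suc N))              ≡⟨ cong (filter P?) (sym (upTo-∷ʳ N)) ⟩
  filter P? (upTo N ++ [ N ])           ≡⟨ filter-++ P? (upTo N) [ N ] ⟩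
  filter P? (upTo N) ++ filter P? [ N ] ≡⟨ cong (_++ filter P? [ N ]) (filter-upTo P? K accept reject N) ⟩
  upTo (N ⊓ K) ++ filter P? [ N ]       ≡⟨ last-step (N <? K) ⟩
  upTo (suc N ⊓ K)                      ∎
  where
  open ≡-Reasoning
  last-step : Dec (N < K) → upTo (N ⊓ K) ++ filter P? [ N ] ≡ upTo (suc N ⊓ K)
  last-step (yes N<K) = begin
    upTo (N ⊓ K) ++ filter P? [ N ] ≡⟨ cong₂ _++_ (cong upTo (m≤n⇒m⊓n≡m (<⇒≤ N<K))) (filter-accept P? (accept N N<K)) ⟩
    upTo N ++ [ N ]                 ≡⟨ upTo-∷ʳ N ⟩
    upTo (suc N)                    ≡⟨ cong upTo (sym (m≤n⇒m⊓n≡m N<K)) ⟩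
    upTo (suc N ⊓ K)                ∎
  last-step (no N≮K) = begin
    upTo (N ⊓ K) ++ filter P? [ N ] ≡⟨ cong₂ _++_ (cong upTo (m≥n⇒m⊓n≡n K≤N)) (filter-reject P? (N≮K ∘ reject N)) ⟩
    upTo K ++ []                    ≡⟨ ++-identityʳ (upTo K) ⟩
    upTo K                          ≡⟨ cong upTo (sym (m≥n⇒m⊓n≡n (m≤n⇒m≤1+n K≤N))) ⟩
    upTo (suc N ⊓ K)                ∎
    where
    K≤N : K ≤ N
    K≤N = ≮⇒≥ N≮K

*≤⇒≤/ : ∀ c p r .{{_ : NonZero p}} → c * p ≤ r → c ≤ r / p
*≤⇒≤/ c p r c*p≤r = subst (_≤ r / p) (m*n/n≡m c p) (/-monoˡ-≤ p c*p≤r)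

≤/⇒*≤ : ∀ c p r .{{_ : NonZero p}} → c ≤ r / p → c * p ≤ r
≤/⇒*≤ c p r c≤r/p = ≤-trans (*-monoˡ-≤ p c≤r/p) (m/n*n≤m r p)

multLists≈partitionSum : ∀ m es r →
  sumᴾ (map (partitionWeight m es) (multLists (map (2 ^_) es) r)) ≈ᴾ partitionSum m es r
multLists≈partitionSum m []       zero    = ⊕-identityʳ oneᴾ
multLists≈partitionSum m []       (suc r) = ≈ᴾ-refl
multLists≈partitionSum m (e ∷ es) r       = begin
  sumᴾ (map (partitionWeight m (e ∷ es)) (concatMap G (filter fits? (upTo (suc r)))))
    ≈⟨ sumᴾ-map-concatMap (partitionWeight m (e ∷ es)) G (filter fits? (upTo (suc r))) ⟩
  sumᴾ (map summand (filter fits? (upTo (suc r))))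
    ≡⟨ cong (sumᴾ ∘ map summand) multiplicities ⟩
  sumᴾ (map summand (upTo (suc (r /2^ e))))
    ≡⟨ Σᴾ.foldr-map-applyUpTo summand (λ c → c) (suc (r /2^ e)) ⟩
  Σᴾ.∑ summand (suc (r /2^ e))
    ≈⟨ Σᴾ.∑-cong (suc (r /2^ e)) (λ c _ → ≈ᴾ-trans (sumᴾ-partitionWeight-∷ m e es c (rest c))
                                                   (⊛-congˡ (partFactor m (e , c)) (multLists≈partitionSum m es (r ∸ c * 2 ^ e)))) ⟩
  partitionSum m (e ∷ es) r
    ∎
  where
  open ≈ᴾ-Reasoning
  instance
    2^e≢0 : NonZero (2 ^ e)
    2^e≢0 = m^n≢0 2 e
  fits? : Decidable (λ c → T (c * 2 ^ e ≤ᵇ r))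
  fits? c = T? (c * 2 ^ e ≤ᵇ r)
  rest : ℕ → List (List ℕ)
  rest c = multLists (map (2 ^_) es) (r ∸ c * 2 ^ e)
  G : ℕ → List (List ℕ)
  G c = map (c ∷_) (rest c)
  summand : ℕ → Poly
  summand c = sumᴾ (map (partitionWeight m (e ∷ es)) (G c))
  multiplicities : filter fits? (upTo (suc r)) ≡ upTo (suc (r /2^ e))
  multiplicities = trans
    (filter-upTo fits? (suc (r /2^ e)) (λ c c≤ → ≤⇒≤ᵇ (≤/⇒*≤ c (2 ^ e) r (≤-pred c≤)))
                                       (λ c fits → s≤s (*≤⇒≤/ c (2 ^ e) r (≤ᵇ⇒≤ (c * 2 ^ e) r fits))) (suc r))
    (cong upTo (m≥n⇒m⊓n≡n (s≤s (m/n≤m r (2 ^ e)))))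

num𝓑≈partitionSum : ∀ m → num𝓑 (suc m) ≈ᴾ partitionSum (suc m) (expsOf (suc m)) (suc m)
num𝓑≈partitionSum m = ≈ᴾ-trans (≈ᴾ-reflexive (cong sumᴾ (map-cong h𝓑≗partitionWeight (𝓑 (suc m)))))
                                (multLists≈partitionSum (suc m) (expsOf (suc m)) (suc m))
  where
  h𝓑≗partitionWeight : ∀ cs → h𝓑 (suc m) cs ≡ partitionWeight (suc m) (expsOf (suc m)) cs
  h𝓑≗partitionWeight cs = cong prodᴾ (map-cong (λ { (e , c) → refl }) (zip (expsOf (suc m)) cs))

partitionSum-∷ʳ-large : ∀ m es e r → m < 2 ^ e → r ≤ m → partitionSum m (es ∷ʳ e) r ≈ᴾ partitionSum m es r
partitionSum-∷ʳ-large m [] e r m<2^e r≤m = begin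
  Σᴾ.∑ term (suc (r /2^ e))                   ≡⟨ cong (Σᴾ.∑ term ∘ suc) (m<n⇒m/n≡0 (≤-<-trans r≤m m<2^e)) ⟩
  term 0 ⊕ zeroᴾ                              ≈⟨ ⊕-identityʳ (term 0) ⟩
  onePlusX2^ e ^ᴾ (m /2^ e) ⊛ partitionSum m [] r
                                              ≡⟨ cong (λ n → onePlusX2^ e ^ᴾ n ⊛ partitionSum m [] r) (m<n⇒m/n≡0 m<2^e) ⟩
  oneᴾ ⊛ partitionSum m [] r                  ≈⟨ ⊛-identityˡ (partitionSum m [] r) ⟩
  partitionSum m [] r                         ∎
  where
  open ≈ᴾ-Reasoning
  instance
    2^e≢0 : NonZero (2 ^ e)
    2^e≢0 = m^n≢0 2 e
  term : ℕ → Poly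
  term c = partFactor m (e , c) ⊛ partitionSum m [] (r ∸ c * 2 ^ e)
partitionSum-∷ʳ-large m (e′ ∷ es) e r m<2^e r≤m = Σᴾ.∑-cong (suc (r /2^ e′)) (λ c _ →
  ⊛-congˡ (partFactor m (e′ , c)) (partitionSum-∷ʳ-large m es e (r ∸ c * 2 ^ e′) m<2^e (≤-trans (m∸n≤m r (c * 2 ^ e′)) r≤m)))

partitionSum-upTo-large : ∀ m K N → m < 2 ^ K → K ≤ N → partitionSum m (upTo N) m ≈ᴾ partitionSum m (upTo K) m
partitionSum-upTo-large m K zero    m<2^K z≤n = ≈ᴾ-refl
partitionSum-upTo-large m K (suc N) m<2^K K≤1+N with m≤n⇒m<n∨m≡n K≤1+N
... | inj₂ refl        = ≈ᴾ-refl
... | inj₁ (s≤s K≤N) = begin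
  partitionSum m (upTo (suc N)) m     ≡⟨ cong (λ es → partitionSum m es m) (sym (upTo-∷ʳ N)) ⟩
  partitionSum m (upTo N ∷ʳ N) m      ≈⟨ partitionSum-∷ʳ-large m (upTo N) N m (≤-trans m<2^K (^-monoʳ-≤ 2 K≤N)) ≤-refl ⟩
  partitionSum m (upTo N) m           ≈⟨ partitionSum-upTo-large m K N m<2^K K≤N ⟩
  partitionSum m (upTo K) m           ∎
  where open ≈ᴾ-Reasoning

n<double[1+⌊n/2⌋] : ∀ n → n < double (suc ⌊ n /2⌋)
n<double[1+⌊n/2⌋] zero          = s≤s z≤n
n<double[1+⌊n/2⌋] (suc zero)    = s≤s (s≤s z≤n)
n<double[1+⌊n/2⌋] (suc (suc n)) = s≤s (s≤s (n<double[1+⌊n/2⌋] n))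

<2^suc⌊log2⌋ : ∀ n (acc : Acc _<_ n) → n < 2 ^ suc (⌊log2⌋ n acc)
<2^suc⌊log2⌋ zero          _        = s≤s z≤n
<2^suc⌊log2⌋ (suc zero)    _        = s≤s (s≤s z≤n)
<2^suc⌊log2⌋ (suc (suc n)) (acc rs) = begin-strict
  suc (suc n)                           <⟨ n<double[1+⌊n/2⌋] (suc (suc n)) ⟩
  double (suc (suc ⌊ n /2⌋))            ≤⟨ double-mono-≤ (<2^suc⌊log2⌋ (suc ⌊ n /2⌋) _) ⟩
  double (2 ^ suc (⌊log2⌋ (suc ⌊ n /2⌋) _)) ≡⟨ double≡2* _ ⟩
  2 ^ suc (⌊log2⌋ (suc (suc n)) (acc rs)) ∎
  where open ≤-Reasoning

⌊log2⌋≤id : ∀ n (acc : Acc _<_ n) → ⌊log2⌋ n acc ≤ n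
⌊log2⌋≤id zero          _        = z≤n
⌊log2⌋≤id (suc zero)    _        = z≤n
⌊log2⌋≤id (suc (suc n)) (acc rs) = s≤s (≤-trans (⌊log2⌋≤id (suc ⌊ n /2⌋) _) (s≤s (⌊n/2⌋≤n n)))

num𝓑≈partitionSum-upTo : ∀ m E → m ≤ E → num𝓑 m ≈ᴾ partitionSum m (upTo (suc E)) m
num𝓑≈partitionSum-upTo zero    E _     = ≈ᴾ-sym (partitionSum-upTo-large 0 0 (suc E) (s≤s z≤n) z≤n)
num𝓑≈partitionSum-upTo (suc m) E 1+m≤E = ≈ᴾ-trans (num𝓑≈partitionSum m)
  (≈ᴾ-sym (partitionSum-upTo-large (suc m) (suc ⌊log₂ suc m ⌋) (suc E)
             (<2^suc⌊log2⌋ (suc m) (<-wellFounded (suc m)))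
             (s≤s (≤-trans (⌊log2⌋≤id (suc m) (<-wellFounded (suc m))) 1+m≤E))))

partitionSum-0∷ : ∀ m es r →
  partitionSum m (0 ∷ es) r ≈ᴾ Σᴾ.∑ (λ c → onePlusX2^ 0 ^ᴾ (m ∸ c) ⊛ partitionSum m es (r ∸ c)) (suc r)
partitionSum-0∷ m es r = begin
  Σᴾ.∑ term (suc (r /2^ 0))
    ≡⟨ cong (Σᴾ.∑ term ∘ suc) (n/1≡n r) ⟩
  Σᴾ.∑ term (suc r)
    ≈⟨ Σᴾ.∑-cong (suc r) (λ c _ → ≈ᴾ-reflexive (cong₂ (λ a b → onePlusX2^ 0 ^ᴾ (a ∸ c) ⊛ partitionSum m es (r ∸ b))
                                                      (n/1≡n m) (*-identityʳ c))) ⟩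
  Σᴾ.∑ (λ c → onePlusX2^ 0 ^ᴾ (m ∸ c) ⊛ partitionSum m es (r ∸ c)) (suc r)
    ∎
  where
  open ≈ᴾ-Reasoning
  term : ℕ → Poly
  term c = partFactor m (0 , c) ⊛ partitionSum m es (r ∸ c * 2 ^ 0)

partitionSum-double : ∀ n es r → partitionSum (double n) (map suc es) (double r) ≈ᴾ sub² (partitionSum n es r)
partitionSum-double n []       zero    = ≈ᴾ-sym sub²-oneᴾ
partitionSum-double n []       (suc r) = ≈ᴾ-sym sub²-zeroᴾ
partitionSum-double n (e ∷ es) r       = begin
  Σᴾ.∑ term (suc (double r /2^ suc e)) ≡⟨ cong (Σᴾ.∑ term ∘ suc) (double/2^suc r e) ⟩
  Σᴾ.∑ term (suc (r /2^ e))            ≈⟨ Σᴾ.∑-cong (suc (r /2^ e)) (λ c _ → term≈sub² c) ⟩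
  Σᴾ.∑ (sub² ∘ term′) (suc (r /2^ e))  ≈⟨ ≈ᴾ-sym (sub²-∑ term′ (suc (r /2^ e))) ⟩
  sub² (partitionSum n (e ∷ es) r)     ∎
  where
  open ≈ᴾ-Reasoning
  term : ℕ → Poly
  term c = partFactor (double n) (suc e , c) ⊛ partitionSum (double n) (map suc es) (double r ∸ c * 2 ^ suc e)
  term′ : ℕ → Poly
  term′ c = partFactor n (e , c) ⊛ partitionSum n es (r ∸ c * 2 ^ e)
  term≈sub² : ∀ c → term c ≈ᴾ sub² (term′ c)
  term≈sub² c = begin
    term c
      ≡⟨ cong₂ (λ a b → onePlusX2^ (suc e) ^ᴾ (a ∸ c) ⊛ partitionSum (double n) (map suc es) b)
               (double/2^suc n e) (trans (cong (double r ∸_) (m*[2*n]≡double[m*n] c (2 ^ e))) (double-∸ r (c * 2 ^ e))) ⟩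
    onePlusX2^ (suc e) ^ᴾ (n /2^ e ∸ c) ⊛ partitionSum (double n) (map suc es) (double (r ∸ c * 2 ^ e))
      ≈⟨ ⊛-cong (^ᴾ-cong (n /2^ e ∸ c) (≈ᴾ-sym (sub²-onePlusX2^ e))) (partitionSum-double n es (r ∸ c * 2 ^ e)) ⟩
    sub² (onePlusX2^ e) ^ᴾ (n /2^ e ∸ c) ⊛ sub² (partitionSum n es (r ∸ c * 2 ^ e))
      ≈⟨ ⊛-congʳ _ (≈ᴾ-sym (sub²-^ᴾ (onePlusX2^ e) (n /2^ e ∸ c))) ⟩
    sub² (partFactor n (e , c)) ⊛ sub² (partitionSum n es (r ∸ c * 2 ^ e))
      ≈⟨ ≈ᴾ-sym (sub²-⊛ (partFactor n (e , c)) (partitionSum n es (r ∸ c * 2 ^ e))) ⟩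
    sub² (term′ c)
      ∎

partitionSum-suc-double : ∀ m es r → partitionSum m (map suc es) (suc (double r)) ≈ᴾ zeroᴾ
partitionSum-suc-double m []       r = ≈ᴾ-refl
partitionSum-suc-double m (e ∷ es) r = Σᴾ.∑-zero (suc (suc (double r) /2^ suc e)) term≈0
  where
  instance
    2^e≢0 : NonZero (2 ^ e)
    2^e≢0 = m^n≢0 2 e
  remainder : ∀ c → c < suc (suc (double r) /2^ suc e) → suc (double r) ∸ c * 2 ^ suc e ≡ suc (double (r ∸ c * 2 ^ e))
  remainder c c<1+q = trans (cong (suc (double r) ∸_) (m*[2*n]≡double[m*n] c (2 ^ e)))
    (trans (+-∸-assoc 1 (double-mono-≤ (≤/⇒*≤ c (2 ^ e) r (subst (c ≤_) (suc-double/2^suc r e) (≤-pred c<1+q)))))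
           (cong suc (double-∸ r (c * 2 ^ e))))
  term≈0 : ∀ c → c < suc (suc (double r) /2^ suc e) →
           partFactor m (suc e , c) ⊛ partitionSum m (map suc es) (suc (double r) ∸ c * 2 ^ suc e) ≈ᴾ zeroᴾ
  term≈0 c c<1+q = ≈ᴾ-trans (⊛-congˡ (partFactor m (suc e , c))
                              (≈ᴾ-trans (≈ᴾ-reflexive (cong (partitionSum m (map suc es)) (remainder c c<1+q)))
                                        (partitionSum-suc-double m es (r ∸ c * 2 ^ e))))
                            (⊛-zeroʳ (partFactor m (suc e , c)))

weightRatio : ℕ → ℕ → List ℕ → Poly
weightRatio m m′ es = prodᴾ (map (λ e → onePlusX2^ e ^ᴾ (m /2^ e ∸ m′ /2^ e)) es)

partitionSum-rescale : ∀ m m′ es r → m′ ≤ m → r ≤ m′ →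
                       partitionSum m es r ≈ᴾ weightRatio m m′ es ⊛ partitionSum m′ es r
partitionSum-rescale m m′ []       zero    _ _ = ≈ᴾ-sym (⊛-identityˡ oneᴾ)
partitionSum-rescale m m′ []       (suc r) _ _ = ≈ᴾ-sym (⊛-identityˡ zeroᴾ)
partitionSum-rescale m m′ (e ∷ es) r m′≤m r≤m′ =
  ≈ᴾ-trans (Σᴾ.∑-cong (suc (r /2^ e)) rescale-term) (Σᴾ.∑-distribˡ (weightRatio m m′ (e ∷ es)) term′ (suc (r /2^ e)))
  where
  open ≈ᴾ-Reasoning
  instance
    2^e≢0 : NonZero (2 ^ e)
    2^e≢0 = m^n≢0 2 e
  q = onePlusX2^ e
  term′ : ℕ → Poly
  term′ c = partFactor m′ (e , c) ⊛ partitionSum m′ es (r ∸ c * 2 ^ e)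
  rescale-term : ∀ c → c < suc (r /2^ e) →
                 partFactor m (e , c) ⊛ partitionSum m es (r ∸ c * 2 ^ e) ≈ᴾ weightRatio m m′ (e ∷ es) ⊛ term′ c
  rescale-term c c<1+q = begin
    q ^ᴾ (m /2^ e ∸ c) ⊛ partitionSum m es r′
      ≈⟨ ⊛-cong (≈ᴾ-trans (≈ᴾ-reflexive (cong (q ^ᴾ_) (m∸o≡[m∸n]+[n∸o] c≤m′/2^e (/-monoˡ-≤ (2 ^ e) m′≤m))))
                          (^ᴾ-+ q (m /2^ e ∸ m′ /2^ e) (m′ /2^ e ∸ c)))
                (partitionSum-rescale m m′ es r′ m′≤m (≤-trans (m∸n≤m r (c * 2 ^ e)) r≤m′)) ⟩
    (q ^ᴾ (m /2^ e ∸ m′ /2^ e) ⊛ q ^ᴾ (m′ /2^ e ∸ c)) ⊛ (weightRatio m m′ es ⊛ partitionSum m′ es r′)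
      ≈⟨ ⊛-interchange (q ^ᴾ (m /2^ e ∸ m′ /2^ e)) (q ^ᴾ (m′ /2^ e ∸ c)) (weightRatio m m′ es) (partitionSum m′ es r′) ⟩
    weightRatio m m′ (e ∷ es) ⊛ term′ c
      ∎
    where
    r′ = r ∸ c * 2 ^ e
    c≤m′/2^e : c ≤ m′ /2^ e
    c≤m′/2^e = ≤-trans (≤-pred c<1+q) (/-monoˡ-≤ (2 ^ e) r≤m′)

val₂-fuel≤fuel : ∀ F n → val₂-fuel F n ≤ F
val₂-fuel≤fuel zero    n       = z≤n
val₂-fuel≤fuel (suc F) zero    = z≤n
val₂-fuel≤fuel (suc F) (suc n) with suc n % 2 ≡ᵇ 0
... | true  = s≤s (val₂-fuel≤fuel F (suc n / 2))
... | false = z≤n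

val₂-fuel-suc-double : ∀ F h → val₂-fuel (suc F) (suc (double h)) ≡ 0
val₂-fuel-suc-double F h =
  cong (λ b → if b ≡ᵇ 0 then suc (val₂-fuel F (suc (double h) / 2)) else 0) (suc-double%2≡1 h)

val₂-fuel-double : ∀ F h → val₂-fuel (suc F) (double (suc h)) ≡ suc (val₂-fuel F (suc h))
val₂-fuel-double F h =
  cong₂ (λ b x → if b ≡ᵇ 0 then suc (val₂-fuel F x) else 0) (double%2≡0 (suc h)) (double/2≡id (suc h))

/2^-pred-gap : ∀ F n → 1 ≤ n → n ≤ F → ∀ j →
  (j ≤ val₂-fuel F n → n /2^ j ∸ pred n /2^ j ≡ 1) × (val₂-fuel F n < j → n /2^ j ∸ pred n /2^ j ≡ 0)
/2^-pred-gap F (suc n) _ _ zero = (λ _ → trans (cong₂ _∸_ (n/1≡n (suc n)) (n/1≡n n)) (m+n∸n≡m 1 n)) , (λ ())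
/2^-pred-gap (suc F) n 1≤n n≤F (suc j) with parity n
... | even (suc h) = (λ j≤v → trans gap-step (proj₁ IH (≤-pred (subst (suc j ≤_) (val₂-fuel-double F h) j≤v))))
                   , (λ v<j → trans gap-step (proj₂ IH (≤-pred (subst (_< suc j) (val₂-fuel-double F h) v<j))))
  where
  IH = /2^-pred-gap F (suc h) (s≤s z≤n) (≤-trans (s≤s (n≤double[n] h)) (≤-pred n≤F)) j
  gap-step : double (suc h) /2^ suc j ∸ suc (double h) /2^ suc j ≡ suc h /2^ j ∸ h /2^ j
  gap-step = cong₂ _∸_ (double/2^suc (suc h) j) (suc-double/2^suc h j)
... | odd h = (λ j≤v → ⊥-elim (<⇒≱ (s≤s z≤n) (subst (suc j ≤_) (val₂-fuel-suc-double F h) j≤v)))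
            , (λ _ → trans (cong₂ _∸_ (suc-double/2^suc h j) (double/2^suc h j)) (n∸n≡0 (h /2^ j)))

weightRatio-double : ∀ n E → val₂ (double (suc n)) ≤ E →
                     weightRatio (double (suc n)) (double n) (map suc (upTo E)) ≈ᴾ f (double (suc n))
weightRatio-double n E val₂≤E = begin
  prodᴾ (map factor (map suc (upTo E)))   ≡⟨ cong prodᴾ (sym (map-∘ (upTo E))) ⟩
  prodᴾ (map (factor ∘ suc) (upTo E))     ≡⟨ prodᴾ-map-applyUpTo (factor ∘ suc) (λ j → j) E ⟩
  ∏ (factor ∘ suc) E                      ≈⟨ ∏-truncate (suc v) E (subst (_≤ E) val₂≡1+v val₂≤E) beyond-val₂ ⟩
  ∏ (factor ∘ suc) (suc v)                ≈⟨ ∏-cong (suc v) up-to-val₂ ⟩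
  ∏ (onePlusX2^ ∘ suc) (suc v)            ≡⟨ sym (prodᴾ-map-applyUpTo (onePlusX2^ ∘ suc) (λ j → j) (suc v)) ⟩
  prodᴾ (map (onePlusX2^ ∘ suc) (upTo (suc v)))
                                          ≡⟨ cong (λ w → prodᴾ (map (onePlusX2^ ∘ suc) (upTo w))) (sym val₂≡1+v) ⟩
  f (double (suc n))                      ∎
  where
  open ≈ᴾ-Reasoning
  factor : ℕ → Poly
  factor e = onePlusX2^ e ^ᴾ (double (suc n) /2^ e ∸ double n /2^ e)
  v : ℕ
  v = val₂-fuel (suc (double n)) (suc n)
  val₂≡1+v : val₂ (double (suc n)) ≡ suc v
  val₂≡1+v = val₂-fuel-double (suc (double n)) n
  gap : ∀ j → (j ≤ v → suc n /2^ j ∸ n /2^ j ≡ 1) × (v < j → suc n /2^ j ∸ n /2^ j ≡ 0)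
  gap = /2^-pred-gap (suc (double n)) (suc n) (s≤s z≤n) (s≤s (n≤double[n] n))
  exponent : ∀ j → double (suc n) /2^ suc j ∸ double n /2^ suc j ≡ suc n /2^ j ∸ n /2^ j
  exponent j = cong₂ _∸_ (double/2^suc (suc n) j) (double/2^suc n j)
  beyond-val₂ : ∀ j → suc v ≤ j → j < E → factor (suc j) ≈ᴾ oneᴾ
  beyond-val₂ j v<j _ = ≈ᴾ-reflexive (cong (onePlusX2^ (suc j) ^ᴾ_) (trans (exponent j) (proj₂ (gap j) v<j)))
  up-to-val₂ : ∀ j → j < suc v → factor (suc j) ≈ᴾ onePlusX2^ (suc j)
  up-to-val₂ j j≤v = ≈ᴾ-trans (≈ᴾ-reflexive (cong (onePlusX2^ (suc j) ^ᴾ_) (trans (exponent j) (proj₁ (gap j) (≤-pred j≤v)))))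
                              (⊛-identityʳ (onePlusX2^ (suc j)))

-- the contribution to partitionSum m (0 ∷ es) m of the partitions with exactly c parts equal to 1
onesTerm : List ℕ → ℕ → ℕ → Poly
onesTerm es m c = onePlusX2^ 0 ^ᴾ (m ∸ c) ⊛ partitionSum m es (m ∸ c)

num𝓑≈∑-ones : ∀ m E → m ≤ E → num𝓑 m ≈ᴾ Σᴾ.∑ (onesTerm (map suc (upTo E)) m) (suc m)
num𝓑≈∑-ones m E m≤E = begin
  num𝓑 m                                       ≈⟨ num𝓑≈partitionSum-upTo m E m≤E ⟩
  partitionSum m (0 ∷ applyUpTo suc E) m       ≡⟨ cong (λ es → partitionSum m (0 ∷ es) m) (sym (map-upTo suc E)) ⟩
  partitionSum m (0 ∷ map suc (upTo E)) m      ≈⟨ partitionSum-0∷ m (map suc (upTo E)) m ⟩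
  Σᴾ.∑ (onesTerm (map suc (upTo E)) m) (suc m) ∎
  where open ≈ᴾ-Reasoning

num𝓑-double : ∀ n → num𝓑 (double (suc n)) ≈ᴾ
  onePlusX2^ 0 ^ᴾ double (suc n) ⊛ sub² (num𝓑 (suc n)) ⊕ f (double (suc n)) ⊛ num𝓑 (double n)
num𝓑-double n = begin
  num𝓑 m
    ≈⟨ num𝓑≈∑-ones m m ≤-refl ⟩
  term 0 ⊕ (term 1 ⊕ Σᴾ.∑ (term ∘ suc ∘ suc) (suc (double n)))
    ≈⟨ ⊕-cong no-ones (⊕-cong one-one (Σᴾ.∑-cong (suc (double n)) two-or-more-ones)) ⟩
  no-ones-value ⊕ Σᴾ.∑ (λ c → f m ⊛ term′ c) (suc (double n))
    ≈⟨ ⊕-congˡ no-ones-value (Σᴾ.∑-distribˡ (f m) term′ (suc (double n))) ⟩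
  no-ones-value ⊕ f m ⊛ Σᴾ.∑ term′ (suc (double n))
    ≈⟨ ⊕-congˡ no-ones-value (⊛-congˡ (f m) (≈ᴾ-sym (num𝓑≈∑-ones (double n) m (double-mono-≤ (n≤1+n n))))) ⟩
  no-ones-value ⊕ f m ⊛ num𝓑 (double n)
    ∎
  where
  open ≈ᴾ-Reasoning
  m = double (suc n)
  es = map suc (upTo m)
  term = onesTerm es m
  term′ = onesTerm es (double n)
  no-ones-value = onePlusX2^ 0 ^ᴾ m ⊛ sub² (num𝓑 (suc n))
  no-ones : term 0 ≈ᴾ no-ones-value
  no-ones = ⊛-congˡ (onePlusX2^ 0 ^ᴾ m) (≈ᴾ-trans (partitionSum-double (suc n) (upTo m) (suc n))
    (sub²-cong (≈ᴾ-sym (num𝓑≈partitionSum-upTo (suc n) (suc (double n)) (s≤s (n≤double[n] n))))))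
  one-one : term 1 ≈ᴾ zeroᴾ
  one-one = ≈ᴾ-trans (⊛-congˡ (onePlusX2^ 0 ^ᴾ suc (double n)) (partitionSum-suc-double m (upTo m) n))
                     (⊛-zeroʳ (onePlusX2^ 0 ^ᴾ suc (double n)))
  two-or-more-ones : ∀ c → c < suc (double n) → term (suc (suc c)) ≈ᴾ f m ⊛ term′ c
  two-or-more-ones c _ = begin
    onePlusX2^ 0 ^ᴾ (double n ∸ c) ⊛ partitionSum m es (double n ∸ c)
      ≈⟨ ⊛-congˡ (onePlusX2^ 0 ^ᴾ (double n ∸ c))
                 (partitionSum-rescale m (double n) es (double n ∸ c) (double-mono-≤ (n≤1+n n)) (m∸n≤m _ c)) ⟩
    onePlusX2^ 0 ^ᴾ (double n ∸ c) ⊛ (weightRatio m (double n) es ⊛ partitionSum (double n) es (double n ∸ c))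
      ≈⟨ x⊛yz≈y⊛xz (onePlusX2^ 0 ^ᴾ (double n ∸ c)) (weightRatio m (double n) es) (partitionSum (double n) es (double n ∸ c)) ⟩
    weightRatio m (double n) es ⊛ term′ c
      ≈⟨ ⊛-congʳ (term′ c) (weightRatio-double n m (val₂-fuel≤fuel m m)) ⟩
    f m ⊛ term′ c
      ∎

theorem4p12 : (n : ℕ) → n ≥ 1 →
    num𝓑 (2 * n) ≈ᴾ ((oneᴾ ⊕ Xᴾ^ 1) ^ᴾ (2 * n)) ⊛ sub² (num𝓑 n) ⊕ f (2 * n) ⊛ num𝓑 (2 * n ∸ 2)
theorem4p12 (suc n) _ =
  subst (λ m → num𝓑 m ≈ᴾ (oneᴾ ⊕ Xᴾ^ 1) ^ᴾ m ⊛ sub² (num𝓑 (suc n)) ⊕ f m ⊛ num𝓑 (m ∸ 2))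
        (double≡2* (suc n)) (num𝓑-double n)
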